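{- A primitive modified ascent sequence avoids $213$ if and only if it avoids both $212$ and $213$; and a primitive modified ascent sequence avoids $231$ if and only if it avoids both $221$ and $231$. That is, $\mathrm{Prim}(212,213)=\mathrm{Prim}(213)$ and $\mathrm{Prim}(221,231)=\mathrm{Prim}(231)$.
   Context: A Cayley permutation of length $n$ is a word $x=x_1\cdots x_n$ of positive integers whose set of values is $\{1,\dots,k\}$ for some $k\le n$. A Cayley permutation $x$ contains $y=y_1\cdots y_k$ if there are indices $i_1<\cdots<i_k$ with $x_{i_s}<x_{i_t}\iff y_s<y_t$ and $x_{i_s}=x_{i_t}\iff y_s=y_t$ for all $s,t$; otherwise $x$ avoids $y$. The ascent tops of $x$ are the pairs $(1,x_1)$ and $(i,x_i)$ with $1<i\le n$ and $x_{i-1}<x_i$; the leftmost copies are the pairs $(\min\{i:x_i=j\},j)$ for $1\le j\le\max(x)$. A modified ascent sequence is a Cayley permutation whose set of ascent tops equals its set of leftmost copies; it is primitive if it has no two consecutive equal entries. $\mathrm{Prim}(B)$ denotes the set of primitive modified ascent sequences avoiding every pattern in $B$. -}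

module Defs where

open import Data.Nat using (ℕ; zero; suc; _<_; _≤_)
open import Data.List using (List; []; _∷_; length; lookup; foldr)
open import Data.List.Relation.Binary.Sublist.Propositional using (_⊆_)
open import Data.List.Membership.Propositional using (_∈_)
open import Data.List.Relation.Unary.All using (All)
open import Data.Fin using (Fin; toℕ) renaming (zero to fzero; suc to fsuc)
open import Data.Product using (Σ; _×_; ∃-syntax)
open import Data.Nat using (_⊔_)
open import Data.Sum using (_⊎_)
open import Relation.Nullary using (¬_)
open import Relation.Binary.PropositionalEquality using (_≡_)
open import Function.Bundles using (_⇔_)

-- Words over positive integers are lists of naturals (entries are checked ≥ 1).
Word : Set
Word = List ℕ

maxW : Word → ℕ
maxW = foldr _⊔_ 0

IsCayley : Word → Set
IsCayley x = All (λ v → 1 ≤ v) x × (∀ j → 1 ≤ j → j ≤ maxW x → j ∈ x)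

OrderIso : Word → Word → Set
OrderIso u v = Σ (length u ≡ length v) λ e →
  ∀ (s t : Fin (length u)) →
    ((lookup u s < lookup u t) ⇔ (lookup v (Data.Fin.cast e s) < lookup v (Data.Fin.cast e t)))
    × ((lookup u s ≡ lookup u t) ⇔ (lookup v (Data.Fin.cast e s) ≡ lookup v (Data.Fin.cast e t)))

Contains : Word → Word → Set
Contains x y = ∃[ z ] (z ⊆ x × OrderIso z y)

Avoids : Word → Word → Set
Avoids x y = ¬ Contains x y

AscentTop : (x : Word) → Fin (length x) → Set
AscentTop x i = toℕ i ≡ 0 ⊎ (∃[ j ] (suc (toℕ j) ≡ toℕ i × lookup x j < lookup x i))

LeftmostCopy : (x : Word) → Fin (length x) → Set
LeftmostCopy x i = ∀ (j : Fin (length x)) → toℕ j < toℕ i → ¬ (lookup x j ≡ lookup x i)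

-- ascent tops coincide with leftmost copies (as sets of pairs (i, x_i);
-- such a pair is determined by its position)
IsModAscent : Word → Set
IsModAscent x = IsCayley x × (∀ i → AscentTop x i ⇔ LeftmostCopy x i)

NoFlat : Word → Set
NoFlat x = ∀ (i j : Fin (length x)) → suc (toℕ i) ≡ toℕ j → ¬ (lookup x i ≡ lookup x j)

IsPrimModAscent : Word → Set
IsPrimModAscent x = IsModAscent x × NoFlat x

InPrim : List Word → Word → Set
InPrim B x = IsPrimModAscent x × All (Avoids x) B

-- In a primitive modified ascent sequence a repeated value is never an ascent
-- top, so the entry just before it is strictly larger.  Hence in an occurrence
-- x_i x_j x_k of 212 the entry before x_k is larger than x_i and, lying after
-- x_j, completes a 213 with x_i x_j; in an occurrence of 221 the entry before
-- x_j is larger than x_i and lies after it, giving a 231 with x_i and x_k.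
module Submission where

open import Defs
open import Data.List using ([]; _∷_; length; lookup)
open import Data.List.Relation.Binary.Sublist.Propositional using (_⊆_; _∷_; _∷ʳ_; minimum)
open import Data.List.Relation.Unary.All using ([]; _∷_)
open import Data.Fin using (Fin; toℕ; inject₁; cast) renaming (zero to fzero; suc to fsuc)
open import Data.Fin.Properties using (toℕ-inject₁; toℕ-injective)
open import Data.Nat using (ℕ; suc; _<_; z≤n; s≤s)
open import Data.Nat.Properties
  using (≤-refl; <-irrefl; <-asym; <-trans; ≤-<-trans; ≤-pred; ≮⇒≥; ≤∧≢⇒<; m≤n⇒m<n∨m≡n)
open import Data.Product using (Σ; _×_; _,_; proj₁; proj₂)
open import Data.Sum using (_⊎_; inj₁; inj₂; map₂)
open import Data.Empty using (⊥-elim)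
open import Function.Bundles using (_⇔_; mk⇔; Equivalence)
open import Function.Properties.Equivalence using () renaming (sym to ⇔-sym)
open import Relation.Nullary using (¬_)
open import Relation.Binary.PropositionalEquality using (_≡_; _≢_; refl; sym; cong; subst)

record Positions₃ (x : Word) : Set where
  constructor positions
  field
    i j k : Fin (length x)
    i<j   : toℕ i < toℕ j
    j<k   : toℕ j < toℕ k

entries : ∀ {x} → Positions₃ x → Word
entries {x} (positions i j k _ _) = lookup x i ∷ lookup x j ∷ lookup x k ∷ []

singleton-⊆ : ∀ (x : Word) (k : Fin (length x)) → lookup x k ∷ [] ⊆ x
singleton-⊆ (v ∷ x) fzero    = refl ∷ minimum x
singleton-⊆ (v ∷ x) (fsuc k) = v ∷ʳ singleton-⊆ x k

pair-⊆ : ∀ (x : Word) (j k : Fin (length x)) → toℕ j < toℕ k →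
         lookup x j ∷ lookup x k ∷ [] ⊆ x
pair-⊆ (v ∷ x) fzero    (fsuc k) _       = refl ∷ singleton-⊆ x k
pair-⊆ (v ∷ x) (fsuc j) (fsuc k) (s≤s p) = v ∷ʳ pair-⊆ x j k p

entries-⊆ : ∀ {x} (p : Positions₃ x) → entries p ⊆ x
entries-⊆ {v ∷ x} (positions fzero (fsuc j) (fsuc k) _ (s≤s q)) = refl ∷ pair-⊆ x j k q
entries-⊆ {v ∷ x} (positions (fsuc i) (fsuc j) (fsuc k) (s≤s p) (s≤s q)) =
  v ∷ʳ entries-⊆ (positions i j k p q)

⊆-singleton⇒position : ∀ {a} (x : Word) → a ∷ [] ⊆ x →
                       Σ (Fin (length x)) λ k → lookup x k ≡ a
⊆-singleton⇒position (v ∷ x) (.v ∷ʳ s) with ⊆-singleton⇒position x s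
... | k , xk = fsuc k , xk
⊆-singleton⇒position (v ∷ x) (v≡a ∷ _) = fzero , sym v≡a

⊆-pair⇒positions : ∀ {a b} (x : Word) → a ∷ b ∷ [] ⊆ x →
  Σ (Fin (length x)) λ j → Σ (Fin (length x)) λ k →
    toℕ j < toℕ k × lookup x j ≡ a × lookup x k ≡ b
⊆-pair⇒positions (v ∷ x) (.v ∷ʳ s) with ⊆-pair⇒positions x s
... | j , k , j<k , xj , xk = fsuc j , fsuc k , s≤s j<k , xj , xk
⊆-pair⇒positions (v ∷ x) (v≡a ∷ s) with ⊆-singleton⇒position x s
... | k , xk = fzero , fsuc k , s≤s z≤n , sym v≡a , xk

⊆-triple⇒positions : ∀ {a b c} (x : Word) → a ∷ b ∷ c ∷ [] ⊆ x →
  Σ (Positions₃ x) λ p → entries p ≡ a ∷ b ∷ c ∷ []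
⊆-triple⇒positions (v ∷ x) (.v ∷ʳ s) with ⊆-triple⇒positions x s
... | positions i j k i<j j<k , refl =
  positions (fsuc i) (fsuc j) (fsuc k) (s≤s i<j) (s≤s j<k) , refl
⊆-triple⇒positions (v ∷ x) (refl ∷ s) with ⊆-pair⇒positions x s
... | j , k , j<k , refl , refl = positions fzero (fsuc j) (fsuc k) (s≤s z≤n) (s≤s j<k) , refl

contains₃⇒positions : ∀ {x} {a b c : ℕ} → Contains x (a ∷ b ∷ c ∷ []) →
  Σ (Positions₃ x) λ p → OrderIso (entries p) (a ∷ b ∷ c ∷ [])
contains₃⇒positions {x} ((_ ∷ _ ∷ _ ∷ []) , s , iso) with ⊆-triple⇒positions x s
... | p , refl = p , iso

positions⇒contains : ∀ {x y} (p : Positions₃ x) → OrderIso (entries p) y → Contains x y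
positions⇒contains p iso = entries p , entries-⊆ p , iso

SameComparison : ℕ → ℕ → ℕ → ℕ → Set
SameComparison a b c d = ((a < b) ⇔ (c < d)) × ((a ≡ b) ⇔ (c ≡ d))

sameComparison-refl : ∀ {a c} → SameComparison a a c c
sameComparison-refl =
  mk⇔ (λ a<a → ⊥-elim (<-irrefl refl a<a)) (λ c<c → ⊥-elim (<-irrefl refl c<c)) ,
  mk⇔ (λ _ → refl) (λ _ → refl)

sameComparison-< : ∀ {a b c d} → a < b → c < d → SameComparison a b c d
sameComparison-< a<b c<d =
  mk⇔ (λ _ → c<d) (λ _ → a<b) ,
  mk⇔ (λ a≡b → ⊥-elim (<-irrefl a≡b a<b)) (λ c≡d → ⊥-elim (<-irrefl c≡d c<d))

sameComparison-> : ∀ {a b c d} → SameComparison a b c d → b < a → d < c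
sameComparison-> (lt , eq) b<a =
  ≤∧≢⇒< (≮⇒≥ λ c<d → <-asym b<a (Equivalence.from lt c<d))
        (λ d≡c → <-irrefl (sym (Equivalence.from eq (sym d≡c))) b<a)

sameComparison-sym : ∀ {a b c d} → SameComparison a b c d → SameComparison b a d c
sameComparison-sym cmp@(lt , eq) =
  mk⇔ (sameComparison-> cmp) (sameComparison-> (⇔-sym lt , ⇔-sym eq)) ,
  mk⇔ (λ b≡a → sym (Equivalence.to eq (sym b≡a))) (λ d≡c → sym (Equivalence.from eq (sym d≡c)))

orderIso₃ : ∀ {a b c p q r} → SameComparison a b p q → SameComparison a c p r →
            SameComparison b c q r → OrderIso (a ∷ b ∷ c ∷ []) (p ∷ q ∷ r ∷ [])
orderIso₃ {a} {b} {c} {p} {q} {r} ab ac bc = refl , compare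
  where
  compare : ∀ (s t : Fin 3) →
    SameComparison (lookup (a ∷ b ∷ c ∷ []) s) (lookup (a ∷ b ∷ c ∷ []) t)
                   (lookup (p ∷ q ∷ r ∷ []) (cast refl s)) (lookup (p ∷ q ∷ r ∷ []) (cast refl t))
  compare fzero               fzero               = sameComparison-refl
  compare fzero               (fsuc fzero)        = ab
  compare fzero               (fsuc (fsuc fzero)) = ac
  compare (fsuc fzero)        fzero               = sameComparison-sym ab
  compare (fsuc fzero)        (fsuc fzero)        = sameComparison-refl
  compare (fsuc fzero)        (fsuc (fsuc fzero)) = bc
  compare (fsuc (fsuc fzero)) fzero               = sameComparison-sym ac
  compare (fsuc (fsuc fzero)) (fsuc fzero)        = sameComparison-sym bc
  compare (fsuc (fsuc fzero)) (fsuc (fsuc fzero)) = sameComparison-refl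

1<2 : 1 < 2
1<2 = s≤s (s≤s z≤n)

2<3 : 2 < 3
2<3 = s≤s 1<2

1<3 : 1 < 3
1<3 = <-trans 1<2 2<3

orderIso-213 : ∀ {a b c} → b < a → a < c → OrderIso (a ∷ b ∷ c ∷ []) (2 ∷ 1 ∷ 3 ∷ [])
orderIso-213 b<a a<c = orderIso₃
  (sameComparison-sym (sameComparison-< b<a 1<2))
  (sameComparison-< a<c 2<3)
  (sameComparison-< (<-trans b<a a<c) 1<3)

orderIso-231 : ∀ {a b c} → a < b → c < a → OrderIso (a ∷ b ∷ c ∷ []) (2 ∷ 3 ∷ 1 ∷ [])
orderIso-231 a<b c<a = orderIso₃
  (sameComparison-< a<b 2<3)
  (sameComparison-sym (sameComparison-< c<a 1<2))
  (sameComparison-sym (sameComparison-< (<-trans c<a a<b) 1<3))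

predecessor : ∀ (x : Word) (k : Fin (length x)) → 0 < toℕ k →
              Σ (Fin (length x)) λ k′ → suc (toℕ k′) ≡ toℕ k
predecessor (_ ∷ _) (fsuc k) _ = inject₁ k , cong suc (toℕ-inject₁ k)

at-or-before-predecessor : ∀ {x : Word} {j k k′ : Fin (length x)} →
  toℕ j < toℕ k → suc (toℕ k′) ≡ toℕ k → toℕ j < toℕ k′ ⊎ j ≡ k′
at-or-before-predecessor {j = j} j<k k′+1≡k =
  map₂ toℕ-injective (m≤n⇒m<n∨m≡n (≤-pred (subst (toℕ j <_) (sym k′+1≡k) j<k)))

repeat-preceded-by-larger : ∀ {x} → IsPrimModAscent x → {i k : Fin (length x)} →
  toℕ i < toℕ k → lookup x i ≡ lookup x k →
  Σ (Fin (length x)) λ k′ → suc (toℕ k′) ≡ toℕ k × lookup x k < lookup x k′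
repeat-preceded-by-larger {x} ((_ , ascentTop⇔leftmost) , noFlat) {i} {k} i<k xi≡xk
  with predecessor x k (≤-<-trans z≤n i<k)
... | k′ , k′+1≡k = k′ , k′+1≡k , ≤∧≢⇒< (≮⇒≥ not-ascent) not-flat
  where
  not-flat : lookup x k ≢ lookup x k′
  not-flat xk≡xk′ = noFlat k′ k k′+1≡k (sym xk≡xk′)
  not-ascent : ¬ (lookup x k′ < lookup x k)
  not-ascent xk′<xk =
    Equivalence.to (ascentTop⇔leftmost k) (inj₂ (k′ , k′+1≡k , xk′<xk)) i i<k xi≡xk

212-occurrence⇒contains-213 : ∀ {x} → IsPrimModAscent x → {i j k : Fin (length x)} →
  toℕ i < toℕ j → toℕ j < toℕ k → lookup x j < lookup x i → lookup x i ≡ lookup x k →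
  Contains x (2 ∷ 1 ∷ 3 ∷ [])
212-occurrence⇒contains-213 {x} prim {i} {j} {k} i<j j<k xj<xi xi≡xk
  with repeat-preceded-by-larger prim (<-trans i<j j<k) xi≡xk
... | k′ , k′+1≡k , xk<xk′ with at-or-before-predecessor {x} j<k k′+1≡k
...   | inj₁ j<k′ = positions⇒contains (positions i j k′ i<j j<k′) (orderIso-213 xj<xi xi<xk′)
  where
  xi<xk′ : lookup x i < lookup x k′
  xi<xk′ = subst (_< lookup x k′) (sym xi≡xk) xk<xk′
...   | inj₂ refl = ⊥-elim (<-asym xj<xi (subst (_< lookup x j) (sym xi≡xk) xk<xk′))

221-occurrence⇒contains-231 : ∀ {x} → IsPrimModAscent x → {i j k : Fin (length x)} →
  toℕ i < toℕ j → toℕ j < toℕ k → lookup x i ≡ lookup x j → lookup x k < lookup x i →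
  Contains x (2 ∷ 3 ∷ 1 ∷ [])
221-occurrence⇒contains-231 {x} prim {i} {j} {k} i<j j<k xi≡xj xk<xi
  with repeat-preceded-by-larger prim i<j xi≡xj
... | j′ , j′+1≡j , xj<xj′ with at-or-before-predecessor {x} i<j j′+1≡j
...   | inj₁ i<j′ = positions⇒contains (positions i j′ k i<j′ j′<k) (orderIso-231 xi<xj′ xk<xi)
  where
  xi<xj′ : lookup x i < lookup x j′
  xi<xj′ = subst (_< lookup x j′) (sym xi≡xj) xj<xj′
  j′<k : toℕ j′ < toℕ k
  j′<k = <-trans (subst (toℕ j′ <_) j′+1≡j ≤-refl) j<k
...   | inj₂ refl = ⊥-elim (<-irrefl (sym xi≡xj) xj<xj′)

avoids-213⇒avoids-212 : ∀ {x} → IsPrimModAscent x →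
  Avoids x (2 ∷ 1 ∷ 3 ∷ []) → Avoids x (2 ∷ 1 ∷ 2 ∷ [])
avoids-213⇒avoids-212 {x} prim avoids-213 occurrence
  with contains₃⇒positions {x} occurrence
... | positions i j k i<j j<k , refl , compare =
  avoids-213 (212-occurrence⇒contains-213 prim i<j j<k
    (Equivalence.from (proj₁ (compare (fsuc fzero) fzero)) 1<2)
    (Equivalence.from (proj₂ (compare fzero (fsuc (fsuc fzero)))) refl))

avoids-231⇒avoids-221 : ∀ {x} → IsPrimModAscent x →
  Avoids x (2 ∷ 3 ∷ 1 ∷ []) → Avoids x (2 ∷ 2 ∷ 1 ∷ [])
avoids-231⇒avoids-221 {x} prim avoids-231 occurrence
  with contains₃⇒positions {x} occurrence
... | positions i j k i<j j<k , refl , compare =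
  avoids-231 (221-occurrence⇒contains-231 prim i<j j<k
    (Equivalence.from (proj₂ (compare fzero (fsuc fzero))) refl)
    (Equivalence.from (proj₁ (compare (fsuc (fsuc fzero)) fzero)) 1<2))

inPrim-drop-implied : ∀ {p q : Word} →
  (∀ {x} → IsPrimModAscent x → Avoids x q → Avoids x p) →
  ∀ (x : Word) → InPrim (p ∷ q ∷ []) x ⇔ InPrim (q ∷ []) x
inPrim-drop-implied implied x =
  mk⇔ (λ { (prim , _ ∷ avoids-q ∷ []) → prim , avoids-q ∷ [] })
      (λ { (prim , avoids-q ∷ []) → prim , implied prim avoids-q ∷ avoids-q ∷ [] })

lemma5p3 : (∀ (x : Word) → InPrim ((2 ∷ 1 ∷ 2 ∷ []) ∷ (2 ∷ 1 ∷ 3 ∷ []) ∷ []) x ⇔ InPrim ((2 ∷ 1 ∷ 3 ∷ []) ∷ []) x)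
    × (∀ (x : Word) → InPrim ((2 ∷ 2 ∷ 1 ∷ []) ∷ (2 ∷ 3 ∷ 1 ∷ []) ∷ []) x ⇔ InPrim ((2 ∷ 3 ∷ 1 ∷ []) ∷ []) x)
lemma5p3 = inPrim-drop-implied avoids-213⇒avoids-212 , inPrim-drop-implied avoids-231⇒avoids-221
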